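{- Let $G$ be a connected graph of order $n\ge3$. Then $3\le\gamma_{qtR}(G)\le n$. Moreover: (i) $\gamma_{qtR}(G)=3$ if and only if $G$ has maximum degree $n-1$; (ii) $\gamma_{qtR}(G)=4$ if and only if $\gamma(G)=\gamma_t(G)=2$; (iii) $\gamma_{qtR}(G)=n$ if and only if $G$ is a path or a cycle of order at least three.
   Context: All graphs are finite, simple and undirected. $\gamma(G)$ is the domination number and $\gamma_t(G)$ the total domination number (minimum size of a set $S$ such that every vertex has a neighbor in $S$). For $f:V(G)\to\{0,1,2\}$ write $V_i=\{v:f(v)=i\}$, weight $\sum_v f(v)$. A quasi-total Roman dominating function (QTRDF) is a function $f:V(G)\to\{0,1,2\}$ such that every vertex $u$ with $f(u)=0$ is adjacent to some $v$ with $f(v)=2$, and every vertex $x$ that is isolated in the subgraph induced by $V_1\cup V_2$ satisfies $f(x)=1$. $\gamma_{qtR}(G)$ is the minimum weight of a QTRDF on $G$. -}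

module Defs where

open import Data.Nat using (ℕ; zero; suc; _+_; _∸_; _⊔_; _≤_)
open import Data.Bool using (Bool; true; false; if_then_else_)
open import Data.Fin using (Fin; toℕ)
open import Data.Fin.Subset using (Subset; _∈_; ∣_∣)
open import Data.Fin.Permutation using (Permutation′; _⟨$⟩ʳ_)
open import Data.List using (List; map; foldr; allFin)
open import Data.Nat.ListAction using (sum)
open import Data.Product using (Σ; ∃; _×_)
open import Relation.Binary.PropositionalEquality using (_≡_; _≢_)
open import Data.Sum using (_⊎_)

record Graph (n : ℕ) : Set where
  field
    adj   : Fin n → Fin n → Bool
    sym   : ∀ u v → adj u v ≡ adj v u
    irrefl : ∀ v → adj v v ≡ false
open Graph public

module _ {n : ℕ} (G : Graph n) where

  Adj : Fin n → Fin n → Set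
  Adj u v = adj G u v ≡ true

  data Walk : Fin n → Fin n → Set where
    here : ∀ {u} → Walk u u
    step : ∀ {u v w} → Adj u v → Walk v w → Walk u w

  Connected : Set
  Connected = ∀ u v → Walk u v

  degree : Fin n → ℕ
  degree v = sum (map (λ u → if adj G v u then 1 else 0) (allFin n))

  maxDegree : ℕ
  maxDegree = foldr _⊔_ 0 (map degree (allFin n))

  IsDominating : Subset n → Set
  IsDominating S = ∀ v → v ∈ S ⊎ ∃ λ u → u ∈ S × Adj v u

  IsTotalDominating : Subset n → Set
  IsTotalDominating S = ∀ v → ∃ λ u → u ∈ S × Adj v u

  IsDominationNumber : ℕ → Set
  IsDominationNumber k =
    (Σ (Subset n) λ S → IsDominating S × ∣ S ∣ ≡ k) ×
    (∀ S → IsDominating S → k ≤ ∣ S ∣)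

  IsTotalDominationNumber : ℕ → Set
  IsTotalDominationNumber k =
    (Σ (Subset n) λ S → IsTotalDominating S × ∣ S ∣ ≡ k) ×
    (∀ S → IsTotalDominating S → k ≤ ∣ S ∣)

  weight : (Fin n → Fin 3) → ℕ
  weight f = sum (map (λ v → toℕ (f v)) (allFin n))

  IsQTRDF : (Fin n → Fin 3) → Set
  IsQTRDF f =
    (∀ u → toℕ (f u) ≡ 0 → ∃ λ v → Adj u v × toℕ (f v) ≡ 2) ×
    -- x isolated in the subgraph induced by V₁ ∪ V₂ (x ∈ V₁ ∪ V₂ and no
    -- neighbour of x lies in V₁ ∪ V₂) implies f(x) = 1
    (∀ x → toℕ (f x) ≢ 0 → (∀ y → Adj x y → toℕ (f y) ≡ 0) → toℕ (f x) ≡ 1)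

  IsQTRNumber : ℕ → Set
  IsQTRNumber k =
    (Σ (Fin n → Fin 3) λ f → IsQTRDF f × weight f ≡ k) ×
    (∀ f → IsQTRDF f → k ≤ weight f)

pathAdj : ∀ {n} → Fin n → Fin n → Set
pathAdj i j = suc (toℕ i) ≡ toℕ j ⊎ suc (toℕ j) ≡ toℕ i

cycleAdj : ∀ {n} → Fin n → Fin n → Set
cycleAdj {n} i j = pathAdj i j ⊎
  ((toℕ i ≡ 0 × suc (toℕ j) ≡ n) ⊎ (toℕ j ≡ 0 × suc (toℕ i) ≡ n))

IsPath : ∀ {n} → Graph n → Set
IsPath {n} G = Σ (Permutation′ n) λ σ →
  ∀ i j → (Adj G (σ ⟨$⟩ʳ i) (σ ⟨$⟩ʳ j) → pathAdj i j) × (pathAdj i j → Adj G (σ ⟨$⟩ʳ i) (σ ⟨$⟩ʳ j))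

IsCycle : ∀ {n} → Graph n → Set
IsCycle {n} G = Σ (Permutation′ n) λ σ →
  ∀ i j → (Adj G (σ ⟨$⟩ʳ i) (σ ⟨$⟩ʳ j) → cycleAdj i j) × (cycleAdj i j → Adj G (σ ⟨$⟩ʳ i) (σ ⟨$⟩ʳ j))

module Submission where

-- Let f be a minimum QTRDF, of weight k.  The all-ones function gives k ≤ n, and a 2 needs a
-- positive neighbour, so k ≥ 3.  If f takes no value 2 then k = n, so by (iii) G is a path or a
-- cycle, whose middle vertex (n = 3) or middle edge (n = 4) dominates.  Otherwise fix x with
-- f x = 2 and a positive neighbour y.
-- (i) 2 on a universal vertex and 1 on one other vertex has weight 3.  Conversely, if k = 3 then
-- f vanishes off {x, y} and x is the only 2, so every vertex but y sees x through its 2-neighbour.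
-- (ii) Twice the indicator of a total dominating pair has weight 4.  Conversely, if k = 4 then at
-- most 1 is left after x and y, which forces an edge at x dominating the graph.
-- (iii) If v has three neighbours a, b, c, then 2 on v, 0 on a and b and 1 elsewhere has weight
-- n − 1.  If every degree is at most 2, each 2 has at most one 0-neighbour, so there are at most
-- as many 0s as 2s and the weight is at least n.  A connected graph of maximum degree at most 2
-- is a path or a cycle: a trail started at a leaf (or anywhere, if there is none) visits every vertex.

open import Defs hiding (sym)
open import Algebra.Properties.CommutativeSemigroup using (x∙yz≈y∙xz)
open import Data.Bool using (Bool; true; false; if_then_else_)
import Data.Bool as Bool
open import Data.Empty using (⊥; ⊥-elim)
open import Data.Fin using (Fin; zero; suc; toℕ; fromℕ<; punchOut)
open import Data.Fin.Patterns using (0F; 1F; 2F; 3F)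
open import Data.Fin.Permutation using (Permutation′; permutation; _⟨$⟩ʳ_; _⟨$⟩ˡ_; inverseʳ)
open import Data.Fin.Properties
  using (_≟_; any?; all?; ¬∀⟶∃¬; toℕ-injective; toℕ<n; toℕ-fromℕ<; injective⇒≤; punchOut-injective)
open import Data.Fin.Subset using (Subset; _∈_; _⊆_; ∣_∣; ⁅_⁆; _∪_)
open import Data.Fin.Subset.Properties
  using (_∈?_; ∣⁅x⁆∣≡1; x∈⁅x⁆; x∈⁅y⁆⇒x≡y; x∈p∪q⁺; p⊂q⇒∣p∣<∣q∣)
open import Data.Vec using ([]; _∷_; lookup)
open import Data.Vec.Properties using ([]=⇒lookup)
open import Data.List using (List; []; _∷_; map; foldr; tabulate; allFin)
open import Data.List.Properties using (map-tabulate; map-cong-local)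
open import Data.List.Relation.Unary.All as All using (All; []; _∷_)
open import Data.List.Relation.Unary.Unique.Propositional using (Unique; []; _∷_)
open import Data.List.Relation.Binary.Pointwise using (Pointwise; []; _∷_)
import Data.Nat.ListAction as List
import Data.Nat as ℕ
open import Data.Nat using (ℕ; zero; suc; _+_; _∸_; _⊔_; _≤_; _<_; z≤n; s≤s)
open import Data.Nat.Properties hiding (_≟_)
open import Algebra.Properties.CommutativeMonoid.Sum +-0-commutativeMonoid
  using (sum; sum-syntax; sum-cong-≗; ∑-distrib-+; ∑-comm)
open import Data.Product using (∃; ∃₂; _×_; _,_; proj₁; proj₂; uncurry)
open import Data.Sum as Sum using (_⊎_; inj₁; inj₂)
open import Relation.Nullary using (¬_; Dec; yes; no; does; ¬?; _×-dec_)
open import Relation.Binary.PropositionalEquality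
open import Function using (case_of_)
open import Function.Bundles using (_⇔_; mk⇔)

variable
  n : ℕ

sum-tabulate : (h : Fin n → ℕ) → List.sum (tabulate h) ≡ ∑[ i < n ] h i
sum-tabulate {zero}  h = refl
sum-tabulate {suc n} h = cong (h zero +_) (sum-tabulate (λ i → h (suc i)))

sum-map-allFin : (h : Fin n → ℕ) → List.sum (map h (allFin n)) ≡ ∑[ i < n ] h i
sum-map-allFin h = trans (cong List.sum (map-tabulate (λ i → i) h)) (sum-tabulate h)

∑-zero : {h : Fin n → ℕ} → (∀ i → h i ≡ 0) → ∑[ i < n ] h i ≡ 0
∑-zero {zero}  h≡0 = refl
∑-zero {suc n} h≡0 = cong₂ _+_ (h≡0 zero) (∑-zero (λ i → h≡0 (suc i)))

∑-one : ∀ n → ∑[ i < n ] 1 ≡ n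
∑-one zero    = refl
∑-one (suc n) = cong suc (∑-one n)

∑-mono-≤ : {g h : Fin n → ℕ} → (∀ i → g i ≤ h i) → ∑[ i < n ] g i ≤ ∑[ i < n ] h i
∑-mono-≤ {zero}  g≤h = z≤n
∑-mono-≤ {suc n} g≤h = +-mono-≤ (g≤h zero) (∑-mono-≤ (λ i → g≤h (suc i)))

zeroAt : Fin n → (Fin n → ℕ) → Fin n → ℕ
zeroAt x h i = if does (i ≟ x) then 0 else h i

zeroAt-≢ : ∀ {x i : Fin n} (h : Fin n → ℕ) → i ≢ x → zeroAt x h i ≡ h i
zeroAt-≢ {x = x} {i} h i≢x with i ≟ x
... | yes i≡x = ⊥-elim (i≢x i≡x)
... | no  _   = refl

∑-zeroAt : (h : Fin n → ℕ) (x : Fin n) → ∑[ i < n ] h i ≡ h x + ∑[ i < n ] zeroAt x h i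
∑-zeroAt h zero    = refl
∑-zeroAt h (suc x) = trans (cong (h zero +_) (∑-zeroAt (λ i → h (suc i)) x))
  (x∙yz≈y∙xz +-commutativeSemigroup (h zero) (h (suc x)) _)

∑-≥-point : (h : Fin n → ℕ) (x : Fin n) → h x ≤ ∑[ i < n ] h i
∑-≥-point h x = ≤-trans (m≤m+n (h x) _) (≤-reflexive (sym (∑-zeroAt h x)))

∑-≥-distinct : (h : Fin n → ℕ) {xs : List (Fin n)} → Unique xs → List.sum (map h xs) ≤ ∑[ i < n ] h i
∑-≥-distinct h []                  = z≤n
∑-≥-distinct h {x ∷ xs} (x∉xs ∷ u) = begin
  h x + List.sum (map h xs)            ≡⟨ cong (λ ys → h x + List.sum ys) (map-cong-local zeroAt-fresh) ⟨
  h x + List.sum (map (zeroAt x h) xs) ≤⟨ +-monoʳ-≤ (h x) (∑-≥-distinct (zeroAt x h) u) ⟩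
  h x + ∑[ i < _ ] zeroAt x h i        ≡⟨ ∑-zeroAt h x ⟨
  ∑[ i < _ ] h i                       ∎
  where
  open ≤-Reasoning
  zeroAt-fresh : All (λ y → zeroAt x h y ≡ h y) xs
  zeroAt-fresh = All.map (λ x≢y → zeroAt-≢ h (λ y≡x → x≢y (sym y≡x))) x∉xs

unique₂ : {A : Set} {x y : A} → y ≢ x → Unique (x ∷ y ∷ [])
unique₂ y≢x = (≢-sym y≢x ∷ []) ∷ [] ∷ []

unique₃ : {A : Set} {x y z : A} → y ≢ x → z ≢ x → z ≢ y → Unique (x ∷ y ∷ z ∷ [])
unique₃ y≢x z≢x z≢y = (≢-sym y≢x ∷ ≢-sym z≢x ∷ []) ∷ unique₂ z≢y

unique₄ : {A : Set} {x y z u : A} → y ≢ x → z ≢ x → z ≢ y → u ≢ x → u ≢ y → u ≢ z → Unique (x ∷ y ∷ z ∷ u ∷ [])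
unique₄ y≢x z≢x z≢y u≢x u≢y u≢z = (≢-sym y≢x ∷ ≢-sym z≢x ∷ ≢-sym u≢x ∷ []) ∷ unique₃ z≢y u≢y u≢z

≤1∧≢1⇒≡0 : ∀ {m} → m ≤ 1 → m ≢ 1 → m ≡ 0
≤1∧≢1⇒≡0 z≤n       _   = refl
≤1∧≢1⇒≡0 (s≤s z≤n) m≢1 = ⊥-elim (m≢1 refl)

sum-≤-pointwise : {A : Set} {h : A → ℕ} {xs : List A} {bs : List ℕ} →
  Pointwise (λ x b → b ≤ h x) xs bs → List.sum bs ≤ List.sum (map h xs)
sum-≤-pointwise []            = z≤n
sum-≤-pointwise (b≤hx ∷ bs≤h) = +-mono-≤ b≤hx (sum-≤-pointwise bs≤h)

∑-≤1 : {h : Fin n → ℕ} → (∀ i → h i ≤ 1) → (∀ i j → h i ≡ 1 → h j ≡ 1 → i ≡ j) → ∑[ i < n ] h i ≤ 1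
∑-≤1 {n} {h} h≤1 h≡1-unique with any? (λ i → h i ℕ.≟ 1)
... | yes (x , hx≡1) = ≤-reflexive (trans (∑-zeroAt h x) (cong₂ _+_ hx≡1 (∑-zero rest)))
  where
  rest : ∀ i → zeroAt x h i ≡ 0
  rest i with i ≟ x
  ... | yes _   = refl
  ... | no  i≢x = ≤1∧≢1⇒≡0 (h≤1 i) (λ hi≡1 → i≢x (h≡1-unique i x hi≡1 hx≡1))
... | no  none = ≤-trans (≤-reflexive (∑-zero (λ i → ≤1∧≢1⇒≡0 (h≤1 i) (λ hi≡1 → none (i , hi≡1))))) z≤n

δ : Fin n → Fin n → ℕ
δ x i = if does (i ≟ x) then 1 else 0

δ-self : (x : Fin n) → δ x x ≡ 1
δ-self x with x ≟ x
... | yes _   = refl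
... | no  x≢x = ⊥-elim (x≢x refl)

δ-≢ : {x i : Fin n} → i ≢ x → δ x i ≡ 0
δ-≢ {x = x} {i} i≢x with i ≟ x
... | yes i≡x = ⊥-elim (i≢x i≡x)
... | no  _   = refl

∑-δ : (x : Fin n) → ∑[ i < n ] δ x i ≡ 1
∑-δ x = trans (∑-zeroAt (δ x) x) (cong₂ _+_ (δ-self x) (∑-zero zeroAt-δ))
  where
  zeroAt-δ : ∀ i → zeroAt x (δ x) i ≡ 0
  zeroAt-δ i with i ≟ x
  ... | yes _   = refl
  ... | no  _   = refl

foldr-⊔-tabulate-≥ : (d : Fin n → ℕ) (i : Fin n) → d i ≤ foldr _⊔_ 0 (tabulate d)
foldr-⊔-tabulate-≥ d zero    = m≤m⊔n _ _
foldr-⊔-tabulate-≥ d (suc i) = ≤-trans (foldr-⊔-tabulate-≥ (λ j → d (suc j)) i) (m≤n⊔m _ _)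

foldr-⊔-tabulate-lub : (d : Fin n → ℕ) {c : ℕ} → (∀ i → d i ≤ c) → foldr _⊔_ 0 (tabulate d) ≤ c
foldr-⊔-tabulate-lub {zero}  d d≤c = z≤n
foldr-⊔-tabulate-lub {suc n} d d≤c = ⊔-lub (d≤c zero) (foldr-⊔-tabulate-lub (λ j → d (suc j)) (λ i → d≤c (suc i)))

foldr-⊔-tabulate-sel : (d : Fin n → ℕ) →
  foldr _⊔_ 0 (tabulate d) ≡ 0 ⊎ ∃ λ i → d i ≡ foldr _⊔_ 0 (tabulate d)
foldr-⊔-tabulate-sel {zero}  d = inj₁ refl
foldr-⊔-tabulate-sel {suc n} d with ⊔-sel (d zero) (foldr _⊔_ 0 (tabulate (λ j → d (suc j))))
... | inj₁ max≡d0 = inj₂ (zero , sym max≡d0)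
... | inj₂ max≡rest with foldr-⊔-tabulate-sel (λ j → d (suc j))
...   | inj₁ rest≡0       = inj₁ (trans max≡rest rest≡0)
...   | inj₂ (i , di≡rest) = inj₂ (suc i , trans di≡rest (sym max≡rest))

∣∣≡∑ : (S : Subset n) → ∣ S ∣ ≡ ∑[ i < n ] (if lookup S i then 1 else 0)
∣∣≡∑ []          = refl
∣∣≡∑ (true  ∷ S) = cong suc (∣∣≡∑ S)
∣∣≡∑ (false ∷ S) = ∣∣≡∑ S

⟨$⟩ˡ⇒⟨$⟩ʳ : ∀ (σ : Permutation′ n) {i j} → σ ⟨$⟩ˡ i ≡ j → σ ⟨$⟩ʳ j ≡ i
⟨$⟩ˡ⇒⟨$⟩ʳ σ refl = inverseʳ σ

injective⇒surjective : (f : Fin n → Fin n) → (∀ {i j} → f i ≡ f j → i ≡ j) → ∀ y → ∃ λ x → f x ≡ y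
injective⇒surjective {suc n} f f-injective y with any? (λ x → f x ≟ y)
... | yes found = found
... | no  none  = ⊥-elim (1+n≰n (injective⇒≤ {f = punched} punched-injective))
  where
  y≢f : ∀ x → y ≢ f x
  y≢f x y≡fx = none (x , sym y≡fx)
  punched : Fin (suc n) → Fin n
  punched x = punchOut (y≢f x)
  punched-injective : ∀ {x x′} → punched x ≡ punched x′ → x ≡ x′
  punched-injective {x} {x′} punched≡ = f-injective (punchOut-injective (y≢f x) (y≢f x′) punched≡)

injective⇒permutation : (f : Fin n → Fin n) → (∀ {i j} → f i ≡ f j → i ≡ j) → Permutation′ n
injective⇒permutation f f-injective = permutation f (λ y → proj₁ (onto y)) (λ y → proj₂ (onto y))
  (λ x → f-injective (proj₂ (onto (f x))))
  where
  onto = injective⇒surjective f f-injective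

another : 1 < n → (v : Fin n) → ∃ λ u → u ≢ v
another (s≤s (s≤s _)) 0F      = 1F , λ ()
another (s≤s (s≤s _)) (suc _) = 0F , λ ()

∣p∪q∣≤∣p∣+∣q∣ : (p q : Subset n) → ∣ p ∪ q ∣ ≤ ∣ p ∣ + ∣ q ∣
∣p∪q∣≤∣p∣+∣q∣ []          []          = z≤n
∣p∪q∣≤∣p∣+∣q∣ (true  ∷ p) (true  ∷ q) =
  s≤s (≤-trans (∣p∪q∣≤∣p∣+∣q∣ p q) (+-monoʳ-≤ ∣ p ∣ (n≤1+n ∣ q ∣)))
∣p∪q∣≤∣p∣+∣q∣ (true  ∷ p) (false ∷ q) = s≤s (∣p∪q∣≤∣p∣+∣q∣ p q)
∣p∪q∣≤∣p∣+∣q∣ (false ∷ p) (true  ∷ q) =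
  ≤-trans (s≤s (∣p∪q∣≤∣p∣+∣q∣ p q)) (≤-reflexive (sym (+-suc ∣ p ∣ ∣ q ∣)))
∣p∪q∣≤∣p∣+∣q∣ (false ∷ p) (false ∷ q) = ∣p∪q∣≤∣p∣+∣q∣ p q

∈∧∈∧≢⇒2≤∣∣ : ∀ {S : Subset n} {x y} → x ∈ S → y ∈ S → y ≢ x → 2 ≤ ∣ S ∣
∈∧∈∧≢⇒2≤∣∣ {S = S} {x} x∈S y∈S y≢x = subst (_< _) (∣⁅x⁆∣≡1 x) (p⊂q⇒∣p∣<∣q∣ (⁅x⁆⊆S , _ , y∈S , y∉⁅x⁆))
  where
  ⁅x⁆⊆S : ⁅ x ⁆ ⊆ S
  ⁅x⁆⊆S z∈⁅x⁆ = subst (_∈ S) (sym (x∈⁅y⁆⇒x≡y x z∈⁅x⁆)) x∈S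
  y∉⁅x⁆ = λ y∈⁅x⁆ → y≢x (x∈⁅y⁆⇒x≡y x y∈⁅x⁆)

∣⁅a⁆∪⁅b⁆∣≡2 : ∀ {a b : Fin n} → b ≢ a → ∣ ⁅ a ⁆ ∪ ⁅ b ⁆ ∣ ≡ 2
∣⁅a⁆∪⁅b⁆∣≡2 {a = a} {b} b≢a = ≤-antisym
  (≤-trans (∣p∪q∣≤∣p∣+∣q∣ ⁅ a ⁆ ⁅ b ⁆) (≤-reflexive (cong₂ _+_ (∣⁅x⁆∣≡1 a) (∣⁅x⁆∣≡1 b))))
  (∈∧∈∧≢⇒2≤∣∣ (x∈p∪q⁺ (inj₁ (x∈⁅x⁆ a))) (x∈p∪q⁺ (inj₂ (x∈⁅x⁆ b))) b≢a)

module _ {n : ℕ} (G : Graph n) where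

  Adj? : ∀ u v → Dec (Adj G u v)
  Adj? u v = adj G u v Bool.≟ true

  Adj-sym : ∀ {u v} → Adj G u v → Adj G v u
  Adj-sym {u} {v} uv = trans (Graph.sym G v u) uv

  Adj-sym-≡ : ∀ {u v w} → Adj G u v → v ≡ w → Adj G w u
  Adj-sym-≡ uv refl = Adj-sym uv

  Adj-irrefl : ∀ {u v} → Adj G u v → u ≢ v
  Adj-irrefl {u} uu refl with trans (sym uu) (irrefl G u)
  ... | ()

  connected⇒everywhere : Connected G → (P : Fin n → Set) → (∀ {u v} → Adj G u v → P u → P v) →
    ∀ {v₀} → P v₀ → ∀ v → P v
  connected⇒everywhere connected P P-closed {v₀} Pv₀ v = along (connected v₀ v) Pv₀
    where
    along : ∀ {u w} → Walk G u w → P u → P w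
    along here          Pu = Pu
    along (step uv vw) Pu = along vw (P-closed uv Pu)

  neighbour : Connected G → ∀ {u v} → u ≢ v → ∃ λ w → Adj G v w
  neighbour connected {u} {v} u≢v with connected v u
  ... | here      = ⊥-elim (u≢v refl)
  ... | step vw _ = _ , vw

  Universal : Fin n → Set
  Universal v = ∀ u → u ≢ v → Adj G v u

  adjacency : Fin n → Fin n → ℕ
  adjacency v u = if adj G v u then 1 else 0

  degree+1≡∑ : ∀ v → degree G v + 1 ≡ ∑[ u < n ] (adjacency v u + δ v u)
  degree+1≡∑ v = begin
    degree G v + 1                                    ≡⟨ cong₂ _+_ (sum-map-allFin (adjacency v)) (sym (∑-δ v)) ⟩
    ∑[ u < n ] adjacency v u + ∑[ u < n ] δ v u       ≡⟨ ∑-distrib-+ (adjacency v) (δ v) ⟨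
    ∑[ u < n ] (adjacency v u + δ v u)                ∎
    where open ≡-Reasoning

  adjacency+δ≤1 : ∀ v u → adjacency v u + δ v u ≤ 1
  adjacency+δ≤1 v u with u ≟ v
  ... | yes refl rewrite irrefl G u = ≤-refl
  ... | no  _    with adj G v u
  ...   | true  = ≤-refl
  ...   | false = z≤n

  degree+1≤n : ∀ v → degree G v + 1 ≤ n
  degree+1≤n v = begin
    degree G v + 1                       ≡⟨ degree+1≡∑ v ⟩
    ∑[ u < n ] (adjacency v u + δ v u)   ≤⟨ ∑-mono-≤ (adjacency+δ≤1 v) ⟩
    ∑[ u < n ] 1                         ≡⟨ ∑-one n ⟩
    n                                    ∎
    where open ≤-Reasoning

  universal⇒degree : ∀ v → Universal v → degree G v + 1 ≡ n
  universal⇒degree v v-univ = begin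
    degree G v + 1                       ≡⟨ degree+1≡∑ v ⟩
    ∑[ u < n ] (adjacency v u + δ v u)   ≡⟨ sum-cong-≗ one ⟩
    ∑[ u < n ] 1                         ≡⟨ ∑-one n ⟩
    n                                    ∎
    where
    open ≡-Reasoning
    one : ∀ u → adjacency v u + δ v u ≡ 1
    one u with u ≟ v
    ... | yes refl rewrite irrefl G u = refl
    ... | no  u≢v  rewrite v-univ u u≢v = refl

  degree⇒universal : ∀ v → degree G v + 1 ≡ n → Universal v
  degree⇒universal v deg≡ u u≢v with adj G v u in vu
  ... | true  = refl
  ... | false = ⊥-elim (1+n≰n (begin
    suc n                                            ≡⟨ cong suc deg≡ ⟨
    suc (degree G v + 1)                             ≡⟨ cong suc (degree+1≡∑ v) ⟩
    suc (∑[ i < n ] (adjacency v i + δ v i))         ≡⟨ cong (_+ _) (∑-δ u) ⟨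
    ∑[ i < n ] δ u i + ∑[ i < n ] (adjacency v i + δ v i)  ≡⟨ ∑-distrib-+ (δ u) _ ⟨
    ∑[ i < n ] (δ u i + (adjacency v i + δ v i))     ≤⟨ ∑-mono-≤ at-most-one ⟩
    ∑[ i < n ] 1                                     ≡⟨ ∑-one n ⟩
    n                                                ∎))
    where
    open ≤-Reasoning
    at-most-one : ∀ i → δ u i + (adjacency v i + δ v i) ≤ 1
    at-most-one i with i ≟ u
    ... | no  _    = adjacency+δ≤1 v i
    ... | yes refl rewrite vu | δ-≢ u≢v = ≤-refl

  maxDegree≡foldr : maxDegree G ≡ foldr _⊔_ 0 (tabulate (degree G))
  maxDegree≡foldr = cong (foldr _⊔_ 0) (map-tabulate (λ i → i) (degree G))

  universal⇒maxDegree≡n∸1 : ∀ v → Universal v → maxDegree G ≡ n ∸ 1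
  universal⇒maxDegree≡n∸1 v v-univ = trans maxDegree≡foldr (≤-antisym
    (foldr-⊔-tabulate-lub (degree G) (λ u → m+n≤o⇒m≤o∸n (degree G u) (degree+1≤n u)))
    (subst (_≤ _) degree≡n∸1 (foldr-⊔-tabulate-≥ (degree G) v)))
    where
    degree≡n∸1 : degree G v ≡ n ∸ 1
    degree≡n∸1 = trans (sym (m+n∸n≡m (degree G v) 1)) (cong (_∸ 1) (universal⇒degree v v-univ))

  maxDegree≡n∸1⇒universal : 1 < n → maxDegree G ≡ n ∸ 1 → ∃ Universal
  maxDegree≡n∸1⇒universal 1<n Δ≡n∸1 with foldr-⊔-tabulate-sel (degree G)
  ... | inj₁ foldr≡0 = ⊥-elim (<⇒≢ (m<n⇒0<n∸m 1<n) (trans (sym foldr≡0) (trans (sym maxDegree≡foldr) Δ≡n∸1)))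
  ... | inj₂ (v , deg≡foldr) = v , degree⇒universal v (begin
    degree G v + 1   ≡⟨ cong (_+ 1) (trans deg≡foldr (trans (sym maxDegree≡foldr) Δ≡n∸1)) ⟩
    n ∸ 1 + 1        ≡⟨ m∸n+n≡m (<⇒≤ 1<n) ⟩
    n                ∎)
    where open ≡-Reasoning

module _ {n : ℕ} (G : Graph n) where

  DominatingEdge : Fin n → Fin n → Set
  DominatingEdge a b = Adj G a b × (∀ u → u ≢ a → u ≢ b → Adj G u a ⊎ Adj G u b)

  universal⇒dominating : ∀ {v} → Universal G v → IsDominating G ⁅ v ⁆
  universal⇒dominating {v} v-univ u with u ≟ v
  ... | yes refl = inj₁ (x∈⁅x⁆ u)
  ... | no  u≢v  = inj₂ (v , x∈⁅x⁆ v , Adj-sym G (v-univ u u≢v))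

  ¬universal⇒2≤dominating : (∀ {v} → ¬ Universal G v) → ∀ {S} → IsDominating G S → Fin n → 2 ≤ ∣ S ∣
  ¬universal⇒2≤dominating ¬universal {S} S-dominating v = two-elements (element (S-dominating v))
    where
    element : v ∈ S ⊎ ∃ (λ u → u ∈ S × Adj G v u) → ∃ (_∈ S)
    element (inj₁ v∈S)           = v , v∈S
    element (inj₂ (u , u∈S , _)) = u , u∈S
    two-elements : ∃ (_∈ S) → 2 ≤ ∣ S ∣
    two-elements (x , x∈S) with any? (λ y → y ∈? S ×-dec ¬? (y ≟ x))
    ... | yes (y , y∈S , y≢x) = ∈∧∈∧≢⇒2≤∣∣ x∈S y∈S y≢x
    ... | no  none            = ⊥-elim (¬universal universal)
      where
      only-x : ∀ {y} → y ∈ S → y ≡ x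
      only-x {y} y∈S with y ≟ x
      ... | yes y≡x = y≡x
      ... | no  y≢x = ⊥-elim (none (y , y∈S , y≢x))
      universal : Universal G x
      universal u u≢x with S-dominating u
      ... | inj₁ u∈S            = ⊥-elim (u≢x (only-x u∈S))
      ... | inj₂ (w , w∈S , uw) = Adj-sym G (subst (Adj G u) (only-x w∈S) uw)

  totalDominating⇒2≤ : ∀ {S} → IsTotalDominating G S → Fin n → 2 ≤ ∣ S ∣
  totalDominating⇒2≤ S-total v with S-total v
  ... | x , x∈S , _ with S-total x
  ...   | y , y∈S , xy = ∈∧∈∧≢⇒2≤∣∣ x∈S y∈S (≢-sym (Adj-irrefl G xy))

  dominatingEdge⇒γ≡γt≡2 : (∀ {v} → ¬ Universal G v) → ∀ {a b} → DominatingEdge a b →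
    IsDominationNumber G 2 × IsTotalDominationNumber G 2
  dominatingEdge⇒γ≡γt≡2 ¬universal {a} {b} (ab , dominated) =
    ((S , (λ v → inj₂ (total v)) , size) , λ _ S′-dominating → ¬universal⇒2≤dominating ¬universal S′-dominating a) ,
    ((S , total , size) , λ _ S′-total → totalDominating⇒2≤ S′-total a)
    where
    S = ⁅ a ⁆ ∪ ⁅ b ⁆
    size = ∣⁅a⁆∪⁅b⁆∣≡2 (≢-sym (Adj-irrefl G ab))
    a∈S : a ∈ S
    a∈S = x∈p∪q⁺ (inj₁ (x∈⁅x⁆ a))
    b∈S : b ∈ S
    b∈S = x∈p∪q⁺ (inj₂ (x∈⁅x⁆ b))
    total : IsTotalDominating G S
    total v with v ≟ a | v ≟ b
    ... | yes refl | _        = b , b∈S , ab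
    ... | no  _    | yes refl = a , a∈S , Adj-sym G ab
    ... | no  v≢a  | no  v≢b  = Sum.[ (λ va → a , a∈S , va) , (λ vb → b , b∈S , vb) ] (dominated v v≢a v≢b)

-- Quasi-total Roman dominating functions

module _ {n : ℕ} (G : Graph n) where

  weight≡∑ : (f : Fin n → Fin 3) → weight G f ≡ ∑[ v < n ] toℕ (f v)
  weight≡∑ f = sum-map-allFin (λ v → toℕ (f v))

  weight-≥ : (f : Fin n → Fin 3) {xs : List (Fin n)} {bs : List ℕ} → Unique xs →
    Pointwise (λ x b → b ≤ toℕ (f x)) xs bs → List.sum bs ≤ weight G f
  weight-≥ f {xs} {bs} xs-distinct bs≤f = begin
    List.sum bs                             ≤⟨ sum-≤-pointwise bs≤f ⟩
    List.sum (map (λ v → toℕ (f v)) xs)     ≤⟨ ∑-≥-distinct (λ v → toℕ (f v)) xs-distinct ⟩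
    ∑[ v < n ] toℕ (f v)                    ≡⟨ weight≡∑ f ⟨
    weight G f                              ∎
    where open ≤-Reasoning

  two⇒positive-neighbour : ∀ {f} → IsQTRDF G f → ∀ {x} → toℕ (f x) ≡ 2 → ∃ λ y → Adj G x y × toℕ (f y) ≢ 0
  two⇒positive-neighbour {f} (_ , isolated⇒1) {x} fx≡2
    with any? (λ y → Adj? G x y ×-dec ¬? (toℕ (f y) ℕ.≟ 0))
  ... | yes found = found
  ... | no  none  = case trans (sym fx≡2) (isolated⇒1 x positive neighbours-zero) of λ ()
    where
    positive : toℕ (f x) ≢ 0
    positive fx≡0 = case trans (sym fx≡2) fx≡0 of λ ()
    neighbours-zero : ∀ y → Adj G x y → toℕ (f y) ≡ 0
    neighbours-zero y xy with toℕ (f y) ℕ.≟ 0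
    ... | yes fy≡0 = fy≡0
    ... | no  fy≢0 = ⊥-elim (none (y , xy , fy≢0))

  positive⇒weight≥n : ∀ f → (∀ x → toℕ (f x) ≢ 0) → n ≤ weight G f
  positive⇒weight≥n f f≢0 = begin
    n                      ≡⟨ ∑-one n ⟨
    ∑[ v < n ] 1           ≤⟨ ∑-mono-≤ (λ v → n≢0⇒n>0 (f≢0 v)) ⟩
    ∑[ v < n ] toℕ (f v)   ≡⟨ weight≡∑ f ⟨
    weight G f             ∎
    where open ≤-Reasoning

  noTwo⇒positive : ∀ {f} → IsQTRDF G f → (∀ x → toℕ (f x) ≢ 2) → ∀ x → toℕ (f x) ≢ 0
  noTwo⇒positive (zero⇒two , _) f≢2 x fx≡0 with zero⇒two x fx≡0
  ... | y , _ , fy≡2 = f≢2 y fy≡2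

  weight≥3 : 3 ≤ n → ∀ {f} → IsQTRDF G f → 3 ≤ weight G f
  weight≥3 3≤n {f} f-qtr with any? (λ x → toℕ (f x) ℕ.≟ 2)
  ... | no  none      = ≤-trans 3≤n (positive⇒weight≥n f (noTwo⇒positive f-qtr (λ x fx≡2 → none (x , fx≡2))))
  ... | yes (x , fx≡2) with two⇒positive-neighbour f-qtr fx≡2
  ...   | y , xy , fy≢0 =
    weight-≥ f (unique₂ (≢-sym (Adj-irrefl G xy))) (≤-reflexive (sym fx≡2) ∷ n≢0⇒n>0 fy≢0 ∷ [])

  one : Fin n → Fin 3
  one _ = 1F

  one-isQTRDF : IsQTRDF G one
  one-isQTRDF = (λ _ ()) , (λ _ _ _ → refl)

  weight-one : weight G one ≡ n
  weight-one = trans (weight≡∑ one) (∑-one n)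

  star : Fin n → Fin n → Fin n → Fin 3
  star v y i with i ≟ v | i ≟ y
  ... | yes _ | _     = 2F
  ... | no  _ | yes _ = 1F
  ... | no  _ | no  _ = 0F

  star-isQTRDF : ∀ {v y} → Universal G v → y ≢ v → IsQTRDF G (star v y)
  star-isQTRDF {v} {y} v-univ y≢v = zero⇒two , isolated⇒one
    where
    star-v : toℕ (star v y v) ≡ 2
    star-v with v ≟ v
    ... | yes _   = refl
    ... | no  v≢v = ⊥-elim (v≢v refl)
    star-y : toℕ (star v y y) ≡ 1
    star-y with y ≟ v | y ≟ y
    ... | yes y≡v | _       = ⊥-elim (y≢v y≡v)
    ... | no  _   | yes _   = refl
    ... | no  _   | no  y≢y = ⊥-elim (y≢y refl)
    zero⇒two : ∀ u → toℕ (star v y u) ≡ 0 → ∃ λ w → Adj G u w × toℕ (star v y w) ≡ 2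
    zero⇒two u _ with u ≟ v | u ≟ y
    zero⇒two u () | yes _   | _
    zero⇒two u () | no  _   | yes _
    ... | no  u≢v | no  _ = v , Adj-sym G (v-univ u u≢v) , star-v
    isolated⇒one : ∀ x → toℕ (star v y x) ≢ 0 → (∀ z → Adj G x z → toℕ (star v y z) ≡ 0) →
      toℕ (star v y x) ≡ 1
    isolated⇒one x positive isolated with x ≟ v | x ≟ y
    ... | yes refl | _     with () ← trans (sym star-y) (isolated y (v-univ y y≢v))
    ... | no  _    | yes _ = refl
    ... | no  _    | no  _ = ⊥-elim (positive refl)

  weight-star : ∀ {v y} → y ≢ v → weight G (star v y) ≡ 3
  weight-star {v} {y} y≢v = begin
    weight G (star v y)                              ≡⟨ weight≡∑ (star v y) ⟩
    ∑[ i < n ] toℕ (star v y i)                      ≡⟨ sum-cong-≗ star-δ ⟩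
    ∑[ i < n ] (δ v i + δ v i + δ y i)               ≡⟨ ∑-distrib-+ (λ i → δ v i + δ v i) (δ y) ⟩
    ∑[ i < n ] (δ v i + δ v i) + ∑[ i < n ] δ y i    ≡⟨ cong (_+ _) (∑-distrib-+ (δ v) (δ v)) ⟩
    ∑[ i < n ] δ v i + ∑[ i < n ] δ v i + ∑[ i < n ] δ y i
      ≡⟨ cong₂ _+_ (cong₂ _+_ (∑-δ v) (∑-δ v)) (∑-δ y) ⟩
    3                                                ∎
    where
    open ≡-Reasoning
    star-δ : ∀ i → toℕ (star v y i) ≡ δ v i + δ v i + δ y i
    star-δ i with i ≟ v | i ≟ y
    ... | yes refl | yes refl = ⊥-elim (y≢v refl)
    ... | yes _    | no  _    = refl
    ... | no  _    | yes _    = refl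
    ... | no  _    | no  _    = refl

  claw : Fin n → Fin n → Fin n → Fin n → Fin 3
  claw v a b i with i ≟ v | i ≟ a | i ≟ b
  ... | yes _ | _     | _     = 2F
  ... | no  _ | yes _ | _     = 0F
  ... | no  _ | no  _ | yes _ = 0F
  ... | no  _ | no  _ | no  _ = 1F

  claw-isQTRDF : ∀ {v a b c} → Adj G v a → Adj G v b → Adj G v c → c ≢ a → c ≢ b → IsQTRDF G (claw v a b)
  claw-isQTRDF {v} {a} {b} {c} va vb vc c≢a c≢b = zero⇒two , isolated⇒one
    where
    claw-v : toℕ (claw v a b v) ≡ 2
    claw-v with v ≟ v
    ... | yes _   = refl
    ... | no  v≢v = ⊥-elim (v≢v refl)
    claw-c : toℕ (claw v a b c) ≡ 1
    claw-c with c ≟ v | c ≟ a | c ≟ b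
    ... | yes refl | _       | _       = ⊥-elim (Adj-irrefl G vc refl)
    ... | no  _    | yes c≡a | _       = ⊥-elim (c≢a c≡a)
    ... | no  _    | no  _   | yes c≡b = ⊥-elim (c≢b c≡b)
    ... | no  _    | no  _   | no  _   = refl
    zero⇒two : ∀ u → toℕ (claw v a b u) ≡ 0 → ∃ λ w → Adj G u w × toℕ (claw v a b w) ≡ 2
    zero⇒two u _ with u ≟ v | u ≟ a | u ≟ b
    zero⇒two u () | yes _ | _        | _
    ... | no  _ | yes refl | _        = v , Adj-sym G va , claw-v
    ... | no  _ | no  _    | yes refl = v , Adj-sym G vb , claw-v
    zero⇒two u () | no  _ | no  _    | no  _
    isolated⇒one : ∀ x → toℕ (claw v a b x) ≢ 0 → (∀ z → Adj G x z → toℕ (claw v a b z) ≡ 0) →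
      toℕ (claw v a b x) ≡ 1
    isolated⇒one x positive isolated with x ≟ v | x ≟ a | x ≟ b
    ... | yes refl | _     | _     with () ← trans (sym claw-c) (isolated c vc)
    ... | no  _    | yes _ | _     = ⊥-elim (positive refl)
    ... | no  _    | no  _ | yes _ = ⊥-elim (positive refl)
    ... | no  _    | no  _ | no  _ = refl

  weight-claw : ∀ {v a b} → Adj G v a → Adj G v b → a ≢ b → weight G (claw v a b) + 1 ≡ n
  weight-claw {v} {a} {b} va vb a≢b = +-cancelʳ-≡ 1 _ _ (begin
    weight G (claw v a b) + 1 + 1                               ≡⟨ +-assoc _ 1 1 ⟩
    weight G (claw v a b) + (1 + 1)                             ≡⟨ cong₂ _+_ (weight≡∑ (claw v a b)) (sym ∑δa+∑δb) ⟩
    ∑[ i < n ] c i + ∑[ i < n ] (δ a i + δ b i)                ≡⟨ ∑-distrib-+ c _ ⟨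
    ∑[ i < n ] (c i + (δ a i + δ b i))                         ≡⟨ sum-cong-≗ claw-δ ⟩
    ∑[ i < n ] (1 + δ v i)                                      ≡⟨ ∑-distrib-+ (λ _ → 1) (δ v) ⟩
    ∑[ i < n ] 1 + ∑[ i < n ] δ v i                             ≡⟨ cong₂ _+_ (∑-one n) (∑-δ v) ⟩
    n + 1                                                       ∎)
    where
    open ≡-Reasoning
    c : Fin n → ℕ
    c i = toℕ (claw v a b i)
    ∑δa+∑δb : ∑[ i < n ] (δ a i + δ b i) ≡ 1 + 1
    ∑δa+∑δb = trans (∑-distrib-+ (δ a) (δ b)) (cong₂ _+_ (∑-δ a) (∑-δ b))
    claw-δ : ∀ i → c i + (δ a i + δ b i) ≡ 1 + δ v i
    claw-δ i with i ≟ v | i ≟ a | i ≟ b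
    ... | yes refl | yes refl | _        = ⊥-elim (Adj-irrefl G va refl)
    ... | yes refl | no  _    | yes refl = ⊥-elim (Adj-irrefl G vb refl)
    ... | yes refl | no  _    | no  _    = refl
    ... | no  _    | yes refl | yes refl = ⊥-elim (a≢b refl)
    ... | no  _    | yes refl | no  _    = refl
    ... | no  _    | no  _    | yes refl = refl
    ... | no  _    | no  _    | no  _    = refl

  double : Subset n → Fin n → Fin 3
  double S i = if lookup S i then 2F else 0F

  double-isQTRDF : ∀ {S} → IsTotalDominating G S → IsQTRDF G (double S)
  double-isQTRDF {S} S-total = zero⇒two , isolated⇒one
    where
    double-∈ : ∀ {w} → w ∈ S → toℕ (double S w) ≡ 2
    double-∈ w∈S rewrite []=⇒lookup w∈S = refl
    zero⇒two : ∀ u → toℕ (double S u) ≡ 0 → ∃ λ w → Adj G u w × toℕ (double S w) ≡ 2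
    zero⇒two u _ with S-total u
    ... | w , w∈S , uw = w , uw , double-∈ w∈S
    isolated⇒one : ∀ x → toℕ (double S x) ≢ 0 → (∀ z → Adj G x z → toℕ (double S z) ≡ 0) →
      toℕ (double S x) ≡ 1
    isolated⇒one x _ isolated with S-total x
    ... | w , w∈S , xw with () ← trans (sym (double-∈ w∈S)) (isolated w xw)

  weight-double : ∀ S → weight G (double S) ≡ ∣ S ∣ + ∣ S ∣
  weight-double S = begin
    weight G (double S)                          ≡⟨ weight≡∑ (double S) ⟩
    ∑[ i < n ] toℕ (double S i)                  ≡⟨ sum-cong-≗ double-χ ⟩
    ∑[ i < n ] (χ i + χ i)                       ≡⟨ ∑-distrib-+ χ χ ⟩
    ∑[ i < n ] χ i + ∑[ i < n ] χ i              ≡⟨ cong₂ _+_ (∣∣≡∑ S) (∣∣≡∑ S) ⟨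
    ∣ S ∣ + ∣ S ∣                                ∎
    where
    open ≡-Reasoning
    χ : Fin n → ℕ
    χ i = (if lookup S i then 1 else 0)
    double-χ : ∀ i → toℕ (double S i) ≡ χ i + χ i
    double-χ i with lookup S i
    ... | true  = refl
    ... | false = refl

-- Graphs of maximum degree at most two

isZero : Fin 3 → ℕ
isZero 0F = 1
isZero _  = 0

isTwo : Fin 3 → ℕ
isTwo 2F = 1
isTwo _  = 0

value+isZero≡1+isTwo : ∀ a → toℕ a + isZero a ≡ 1 + isTwo a
value+isZero≡1+isTwo 0F = refl
value+isZero≡1+isTwo 1F = refl
value+isZero≡1+isTwo 2F = refl

zeroToTwo : Fin 3 → Bool → Fin 3 → ℕ
zeroToTwo 0F true 2F = 1
zeroToTwo _  _    _  = 0

zeroToTwo≤1 : ∀ a b c → zeroToTwo a b c ≤ 1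
zeroToTwo≤1 0F true 2F = ≤-refl
zeroToTwo≤1 0F true 0F = z≤n
zeroToTwo≤1 0F true 1F = z≤n
zeroToTwo≤1 0F false _ = z≤n
zeroToTwo≤1 1F _ _     = z≤n
zeroToTwo≤1 2F _ _     = z≤n

zeroToTwo≡1 : ∀ {a b c} → zeroToTwo a b c ≡ 1 → a ≡ 0F × b ≡ true
zeroToTwo≡1 {0F} {true} {2F} _ = refl , refl
zeroToTwo≡1 {0F} {true} {0F} ()
zeroToTwo≡1 {0F} {true} {1F} ()
zeroToTwo≡1 {0F} {false}     ()
zeroToTwo≡1 {1F}             ()
zeroToTwo≡1 {2F}             ()

zeroToTwo-≢2F : ∀ a b {c} → c ≢ 2F → zeroToTwo a b c ≡ 0
zeroToTwo-≢2F 0F true {0F} _   = refl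
zeroToTwo-≢2F 0F true {1F} _   = refl
zeroToTwo-≢2F 0F true {2F} c≢2 = ⊥-elim (c≢2 refl)
zeroToTwo-≢2F 0F false _       = refl
zeroToTwo-≢2F 1F _ _           = refl
zeroToTwo-≢2F 2F _ _           = refl

module _ {n : ℕ} (G : Graph n) where

  MaxDegree≤2 : Set
  MaxDegree≤2 = ∀ {v a b c} → Adj G v a → Adj G v b → Adj G v c → a ≡ b ⊎ a ≡ c ⊎ b ≡ c

  -- Discharging: a 2 has at most one 0-neighbour, as one of its at most two neighbours is positive.
  maxDegree≤2⇒weight≥n : MaxDegree≤2 → ∀ {f} → IsQTRDF G f → n ≤ weight G f
  maxDegree≤2⇒weight≥n Δ≤2 {f} f-qtr@(zero⇒two , _) =
    +-cancelʳ-≤ zeros n (weight G f) (begin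
      n + zeros      ≤⟨ +-monoʳ-≤ n zeros≤twos ⟩
      n + twos       ≡⟨ balance ⟨
      weight G f + zeros  ∎)
    where
    open ≤-Reasoning
    zeros twos : ℕ
    zeros = ∑[ i < n ] isZero (f i)
    twos  = ∑[ i < n ] isTwo (f i)
    balance : weight G f + zeros ≡ n + twos
    balance = begin-equality
      weight G f + zeros                       ≡⟨ cong (_+ zeros) (weight≡∑ G f) ⟩
      ∑[ i < n ] toℕ (f i) + zeros             ≡⟨ ∑-distrib-+ (λ i → toℕ (f i)) (λ i → isZero (f i)) ⟨
      ∑[ i < n ] (toℕ (f i) + isZero (f i))    ≡⟨ sum-cong-≗ (λ i → value+isZero≡1+isTwo (f i)) ⟩
      ∑[ i < n ] (1 + isTwo (f i))             ≡⟨ ∑-distrib-+ (λ _ → 1) (λ i → isTwo (f i)) ⟩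
      ∑[ i < n ] 1 + twos                      ≡⟨ cong (_+ twos) (∑-one n) ⟩
      n + twos                                 ∎
    M : Fin n → Fin n → ℕ
    M i j = zeroToTwo (f i) (adj G i j) (f j)
    row : ∀ i → isZero (f i) ≤ ∑[ j < n ] M i j
    row i with f i in fi≡
    ... | 1F = z≤n
    ... | 2F = z≤n
    ... | 0F with zero⇒two i (cong toℕ fi≡)
    ...   | j , ij , fj≡2 = ≤-trans (≤-reflexive (sym Mij≡1)) (∑-≥-point _ j)
      where
      Mij≡1 : zeroToTwo 0F (adj G i j) (f j) ≡ 1
      Mij≡1 rewrite ij | toℕ-injective {i = f j} {j = 2F} fj≡2 = refl
    column : ∀ j → ∑[ i < n ] M i j ≤ isTwo (f j)
    column j with f j ≟ 2F
    ... | no  fj≢2 = ≤-trans (≤-reflexive (∑-zero (λ i → zeroToTwo-≢2F (f i) (adj G i j) fj≢2))) z≤n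
    ... | yes fj≡2 with two⇒positive-neighbour G f-qtr (cong toℕ fj≡2)
    ...   | y , jy , fy≢0 rewrite fj≡2 = ∑-≤1 (λ i → zeroToTwo≤1 (f i) (adj G i j) 2F) unique
      where
      unique : ∀ i i′ → zeroToTwo (f i) (adj G i j) 2F ≡ 1 → zeroToTwo (f i′) (adj G i′ j) 2F ≡ 1 → i ≡ i′
      unique i i′ Mij≡1 Mi′j≡1 with zeroToTwo≡1 Mij≡1 | zeroToTwo≡1 Mi′j≡1
      ... | fi≡0 , ij | fi′≡0 , i′j with Δ≤2 (Adj-sym G ij) (Adj-sym G i′j) jy
      ...   | inj₁ i≡i′        = i≡i′
      ...   | inj₂ (inj₁ refl) = ⊥-elim (fy≢0 (cong toℕ fi≡0))
      ...   | inj₂ (inj₂ refl) = ⊥-elim (fy≢0 (cong toℕ fi′≡0))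
    zeros≤twos : zeros ≤ twos
    zeros≤twos = begin
      zeros                          ≤⟨ ∑-mono-≤ row ⟩
      ∑[ i < n ] ∑[ j < n ] M i j    ≡⟨ ∑-comm M ⟩
      ∑[ j < n ] ∑[ i < n ] M i j    ≤⟨ ∑-mono-≤ column ⟩
      twos                           ∎

-- Paths and cycles

three-into-two : {A : Set} {x y z p q : A} → x ≡ p ⊎ x ≡ q → y ≡ p ⊎ y ≡ q → z ≡ p ⊎ z ≡ q →
  x ≡ y ⊎ x ≡ z ⊎ y ≡ z
three-into-two (inj₁ refl) (inj₁ refl) _           = inj₁ refl
three-into-two (inj₂ refl) (inj₂ refl) _           = inj₁ refl
three-into-two (inj₁ refl) (inj₂ _)    (inj₁ refl) = inj₂ (inj₁ refl)
three-into-two (inj₂ refl) (inj₁ _)    (inj₂ refl) = inj₂ (inj₁ refl)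
three-into-two (inj₁ _)    (inj₂ refl) (inj₂ refl) = inj₂ (inj₂ refl)
three-into-two (inj₂ _)    (inj₁ refl) (inj₁ refl) = inj₂ (inj₂ refl)

module _ {n : ℕ} (G : Graph n) where

  embedding⇒maxDegree≤2 : (R : Fin n → Fin n → Set) (σ : Permutation′ n) →
    (∀ i j → Adj G (σ ⟨$⟩ʳ i) (σ ⟨$⟩ʳ j) → R i j) →
    (∀ i → ∃₂ λ p q → ∀ j → R i j → toℕ j ≡ p ⊎ toℕ j ≡ q) → MaxDegree≤2 G
  embedding⇒maxDegree≤2 R σ G⇒R R-sparse {v} va vb vc with R-sparse (σ ⟨$⟩ˡ v)
  ... | p , q , R⇒p∨q =
    Sum.map π-injective (Sum.map π-injective π-injective) (three-into-two (index va) (index vb) (index vc))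
    where
    π : Fin n → ℕ
    π x = toℕ (σ ⟨$⟩ˡ x)
    π-injective : ∀ {x y} → π x ≡ π y → x ≡ y
    π-injective {x} {y} πx≡πy = begin
      x                      ≡⟨ inverseʳ σ ⟨
      σ ⟨$⟩ʳ (σ ⟨$⟩ˡ x)      ≡⟨ cong (σ ⟨$⟩ʳ_) (toℕ-injective πx≡πy) ⟩
      σ ⟨$⟩ʳ (σ ⟨$⟩ˡ y)      ≡⟨ inverseʳ σ ⟩
      y                      ∎
      where open ≡-Reasoning
    index : ∀ {x} → Adj G v x → π x ≡ p ⊎ π x ≡ q
    index {x} vx = R⇒p∨q _ (G⇒R _ _ (subst₂ (Adj G) (sym (inverseʳ σ)) (sym (inverseʳ σ)) vx))

  path⇒maxDegree≤2 : IsPath G → MaxDegree≤2 G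
  path⇒maxDegree≤2 (σ , iso) = embedding⇒maxDegree≤2 pathAdj σ (λ i j → proj₁ (iso i j)) neighbours
    where
    neighbours : ∀ i → ∃₂ λ p q → ∀ j → pathAdj i j → toℕ j ≡ p ⊎ toℕ j ≡ q
    neighbours i = suc (toℕ i) , toℕ i ∸ 1 , λ where
      j (inj₁ 1+i≡j) → inj₁ (sym 1+i≡j)
      j (inj₂ 1+j≡i) → inj₂ (cong (_∸ 1) 1+j≡i)

  cycle⇒maxDegree≤2 : IsCycle G → MaxDegree≤2 G
  cycle⇒maxDegree≤2 (σ , iso) = embedding⇒maxDegree≤2 cycleAdj σ (λ i j → proj₁ (iso i j)) neighbours
    where
    neighbours : ∀ i → ∃₂ λ p q → ∀ j → cycleAdj i j → toℕ j ≡ p ⊎ toℕ j ≡ q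
    neighbours i with toℕ i ℕ.≟ 0 | suc (toℕ i) ℕ.≟ n
    ... | yes i≡0 | _ = 1 , n ∸ 1 , λ where
      j (inj₁ (inj₁ 1+i≡j))        → inj₁ (trans (sym 1+i≡j) (cong suc i≡0))
      j (inj₁ (inj₂ 1+j≡i))        → ⊥-elim (1+n≢0 (trans 1+j≡i i≡0))
      j (inj₂ (inj₁ (_ , 1+j≡n)))  → inj₂ (cong (_∸ 1) 1+j≡n)
      j (inj₂ (inj₂ (j≡0 , 1+i≡n))) → inj₂ (trans j≡0 (cong (_∸ 1) (trans (cong suc (sym i≡0)) 1+i≡n)))
    ... | no i≢0 | yes 1+i≡n = toℕ i ∸ 1 , 0 , λ where
      j (inj₁ (inj₁ 1+i≡j))        → ⊥-elim (<-irrefl (trans (sym 1+i≡j) 1+i≡n) (toℕ<n j))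
      j (inj₁ (inj₂ 1+j≡i))        → inj₁ (cong (_∸ 1) 1+j≡i)
      j (inj₂ (inj₁ (i≡0 , _)))    → ⊥-elim (i≢0 i≡0)
      j (inj₂ (inj₂ (j≡0 , _)))    → inj₂ j≡0
    ... | no i≢0 | no 1+i≢n = suc (toℕ i) , toℕ i ∸ 1 , λ where
      j (inj₁ (inj₁ 1+i≡j))        → inj₁ (sym 1+i≡j)
      j (inj₁ (inj₂ 1+j≡i))        → inj₂ (cong (_∸ 1) 1+j≡i)
      j (inj₂ (inj₁ (i≡0 , _)))    → ⊥-elim (i≢0 i≡0)
      j (inj₂ (inj₂ (_ , 1+i≡n)))  → ⊥-elim (1+i≢n 1+i≡n)

  pathOrCycle⇒MaxDegree≤2 : IsPath G ⊎ IsCycle G → MaxDegree≤2 G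
  pathOrCycle⇒MaxDegree≤2 (inj₁ path)  = path⇒maxDegree≤2 path
  pathOrCycle⇒MaxDegree≤2 (inj₂ cycle) = cycle⇒maxDegree≤2 cycle

  HamiltonianPath : Permutation′ n → Set
  HamiltonianPath σ = ∀ i j → pathAdj i j → Adj G (σ ⟨$⟩ʳ i) (σ ⟨$⟩ʳ j)

  pathOrCycle⇒hamiltonianPath : IsPath G ⊎ IsCycle G → ∃ HamiltonianPath
  pathOrCycle⇒hamiltonianPath (inj₁ (σ , iso)) = σ , λ i j ij → proj₂ (iso i j) ij
  pathOrCycle⇒hamiltonianPath (inj₂ (σ , iso)) = σ , λ i j ij → proj₂ (iso i j) (inj₁ ij)

  hamiltonianPath₃⇒universal : n ≡ 3 → ∀ σ → HamiltonianPath σ → ∃ (Universal G)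
  hamiltonianPath₃⇒universal refl σ path = σ ⟨$⟩ʳ 1F , universal
    where
    universal : Universal G (σ ⟨$⟩ʳ 1F)
    universal u u≢σ1 with σ ⟨$⟩ˡ u in σ⁻¹u≡
    ... | 0F = subst (Adj G _) (⟨$⟩ˡ⇒⟨$⟩ʳ σ σ⁻¹u≡) (path 1F 0F (inj₂ refl))
    ... | 1F = ⊥-elim (u≢σ1 (sym (⟨$⟩ˡ⇒⟨$⟩ʳ σ σ⁻¹u≡)))
    ... | 2F = subst (Adj G _) (⟨$⟩ˡ⇒⟨$⟩ʳ σ σ⁻¹u≡) (path 1F 2F (inj₁ refl))

  hamiltonianPath₄⇒dominatingEdge : n ≡ 4 → ∀ σ → HamiltonianPath σ → ∃₂ (DominatingEdge G)
  hamiltonianPath₄⇒dominatingEdge refl σ path = σ ⟨$⟩ʳ 1F , σ ⟨$⟩ʳ 2F , path 1F 2F (inj₁ refl) , dominated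
    where
    dominated : ∀ u → u ≢ σ ⟨$⟩ʳ 1F → u ≢ σ ⟨$⟩ʳ 2F → Adj G u (σ ⟨$⟩ʳ 1F) ⊎ Adj G u (σ ⟨$⟩ʳ 2F)
    dominated u u≢σ1 u≢σ2 with σ ⟨$⟩ˡ u in σ⁻¹u≡
    ... | 0F = inj₁ (subst (λ x → Adj G x _) (⟨$⟩ˡ⇒⟨$⟩ʳ σ σ⁻¹u≡) (path 0F 1F (inj₁ refl)))
    ... | 1F = ⊥-elim (u≢σ1 (sym (⟨$⟩ˡ⇒⟨$⟩ʳ σ σ⁻¹u≡)))
    ... | 2F = ⊥-elim (u≢σ2 (sym (⟨$⟩ˡ⇒⟨$⟩ʳ σ σ⁻¹u≡)))
    ... | 3F = inj₂ (subst (λ x → Adj G x _) (⟨$⟩ˡ⇒⟨$⟩ʳ σ σ⁻¹u≡) (path 3F 2F (inj₂ refl)))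

module _ {n : ℕ} (G : Graph n) where

  TwoNeighbours : Fin n → Set
  TwoNeighbours v = ∃₂ λ a b → Adj G v a × Adj G v b × a ≢ b

  twoNeighbours? : ∀ v → Dec (TwoNeighbours v)
  twoNeighbours? v = any? (λ a → any? (λ b → Adj? G v a ×-dec (Adj? G v b ×-dec ¬? (a ≟ b))))

  ¬twoNeighbours⇒leaf : ∀ {v} → ¬ TwoNeighbours v → ∀ {a b} → Adj G v a → Adj G v b → a ≡ b
  ¬twoNeighbours⇒leaf ¬two {a} {b} va vb with a ≟ b
  ... | yes a≡b = a≡b
  ... | no  a≢b = ⊥-elim (¬two (a , b , va , vb , a≢b))

data Position (m : ℕ) : ℕ → Set where
  first : Position m 0
  last  : Position m m
  inner : ∀ {i} → suc i < m → Position m (suc i)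

position : ∀ {m i} → i ≤ m → Position m i
position {m}     {zero}  _         = first
position {suc m} {suc i} (s≤s i≤m) with i ℕ.≟ m
... | yes refl = last
... | no  i≢m  = inner (s≤s (≤∧≢⇒< i≤m i≢m))

-- The trail s₀ s₁ s₂ … leaves each vertex by an edge other than the one it arrived on.
module Trail {n : ℕ} (G : Graph n) (Δ≤2 : MaxDegree≤2 G) (connected : Connected G)
             (s₀ s₁ : Fin n) (s₀s₁ : Adj G s₀ s₁) where

  next : Fin n → Fin n → Fin n
  next p c with any? (λ u → Adj? G c u ×-dec ¬? (u ≟ p))
  ... | yes (u , _) = u
  ... | no  _       = p

  next-spec : ∀ {p c u} → Adj G c u → u ≢ p → Adj G c (next p c) × next p c ≢ p
  next-spec {p} {c} {u} cu u≢p with any? (λ u → Adj? G c u ×-dec ¬? (u ≟ p))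
  ... | yes (_ , found) = found
  ... | no  none        = ⊥-elim (none (u , cu , u≢p))

  steps : ℕ → Fin n × Fin n
  steps zero    = s₀ , s₁
  steps (suc k) = proj₂ (steps k) , next (proj₁ (steps k)) (proj₂ (steps k))

  s : ℕ → Fin n
  s k = proj₁ (steps k)

  record Simple (m : ℕ) : Set where
    field
      adjacent  : ∀ {i} → i < m → Adj G (s i) (s (suc i))
      injective : ∀ {i j} → i ≤ m → j ≤ m → s i ≡ s j → i ≡ j
  open Simple

  OnPrefix : ℕ → Fin n → Set
  OnPrefix m u = ∃ λ j → j ≤ m × u ≡ s j

  simple₁ : Simple 1
  simple₁ = record { adjacent = adjacent₁ ; injective = injective₁ }
    where
    adjacent₁ : ∀ {i} → i < 1 → Adj G (s i) (s (suc i))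
    adjacent₁ (s≤s z≤n) = s₀s₁
    injective₁ : ∀ {i j} → i ≤ 1 → j ≤ 1 → s i ≡ s j → i ≡ j
    injective₁ {0} {0} _ _ _ = refl
    injective₁ {1} {1} _ _ _ = refl
    injective₁ {0} {1} _ _ s₀≡s₁ = ⊥-elim (Adj-irrefl G s₀s₁ s₀≡s₁)
    injective₁ {1} {0} _ _ s₁≡s₀ = ⊥-elim (Adj-irrefl G s₀s₁ (sym s₁≡s₀))
    injective₁ {suc (suc _)} (s≤s ())
    injective₁ {_} {suc (suc _)} _ (s≤s ())

  inner-neighbours : ∀ {m i u} → Simple m → suc i < m → Adj G (s (suc i)) u → u ≡ s i ⊎ u ≡ s (suc (suc i))
  inner-neighbours {m} {i} simple 1+i<m su
    with Δ≤2 su (Adj-sym G (adjacent simple (<-trans (n<1+n i) 1+i<m))) (adjacent simple 1+i<m)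
  ... | inj₁ u≡si      = inj₁ u≡si
  ... | inj₂ (inj₁ u≡s2+i) = inj₂ u≡s2+i
  ... | inj₂ (inj₂ si≡s2+i) = ⊥-elim (m≢2+m (injective simple (≤-trans (n≤1+n i) (<⇒≤ 1+i<m)) 1+i<m si≡s2+i))
    where
    m≢2+m : ∀ {m} → m ≢ suc (suc m)
    m≢2+m ()

  prefix-escapes : ∀ {k} → Simple (suc k) → suc (suc k) < n →
    (∀ {u} → Adj G (s 0) u → OnPrefix (suc k) u) → (∀ {u} → Adj G (s (suc k)) u → OnPrefix (suc k) u) → ⊥
  prefix-escapes {k} simple bound start-closed end-closed =
    <⇒≱ bound (injective⇒≤ {f = index} index-injective)
    where
    closed : ∀ {u v} → Adj G u v → OnPrefix (suc k) u → OnPrefix (suc k) v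
    closed uv (j , j≤1+k , refl) with position j≤1+k
    ... | first = start-closed uv
    ... | last  = end-closed uv
    ... | inner {i} 1+i<1+k with inner-neighbours simple 1+i<1+k uv
    ...   | inj₁ v≡si   = i , ≤-trans (n≤1+n i) (<⇒≤ 1+i<1+k) , v≡si
    ...   | inj₂ v≡s2+i = suc (suc i) , 1+i<1+k , v≡s2+i
    on-prefix : ∀ v → OnPrefix (suc k) v
    on-prefix = connected⇒everywhere G connected (OnPrefix (suc k)) closed (0 , z≤n , refl)
    index : Fin n → Fin (suc (suc k))
    index v = fromℕ< (s≤s (proj₁ (proj₂ (on-prefix v))))
    index-injective : ∀ {u v} → index u ≡ index v → u ≡ v
    index-injective {u} {v} index≡ = begin
      u                             ≡⟨ proj₂ (proj₂ (on-prefix u)) ⟩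
      s (proj₁ (on-prefix u))       ≡⟨ cong s (trans (sym (toℕ-fromℕ< _)) (trans (cong toℕ index≡) (toℕ-fromℕ< _)))
                                     ⟩
      s (proj₁ (on-prefix v))       ≡⟨ proj₂ (proj₂ (on-prefix v)) ⟨
      v                             ∎
      where open ≡-Reasoning

  extend : ∀ {k} → Simple (suc k) → Adj G (s (suc k)) (s (suc (suc k))) →
    s (suc (suc k)) ≢ s k → s (suc (suc k)) ≢ s 0 → Simple (suc (suc k))
  extend {k} simple new-edge ≢sk ≢s₀ = record { adjacent = adjacent′ ; injective = injective′ }
    where
    adjacent′ : ∀ {i} → i < suc (suc k) → Adj G (s i) (s (suc i))
    adjacent′ i<2+k with m≤n⇒m<n∨m≡n (≤-pred i<2+k)
    ... | inj₁ i<1+k = adjacent simple i<1+k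
    ... | inj₂ refl  = new-edge
    fresh : ∀ {j} → j ≤ suc k → s (suc (suc k)) ≢ s j
    fresh j≤1+k with m≤n⇒m<n∨m≡n j≤1+k
    ... | inj₂ refl = Adj-irrefl G (Adj-sym G new-edge)
    ... | inj₁ (s≤s j≤k) with position j≤k
    ...   | first = ≢s₀
    ...   | last  = ≢sk
    ...   | inner {i} 1+i<k = λ s2+k≡s1+i →
      case inner-neighbours simple (≤-trans 1+i<k (n≤1+n k)) (Adj-sym-≡ G new-edge s2+k≡s1+i) of λ where
        (inj₁ s1+k≡si)   → <⇒≢ i<1+k (sym (injective simple {suc k} {i} ≤-refl (<⇒≤ i<1+k) s1+k≡si))
        (inj₂ s1+k≡s2+i) →
          <⇒≢ (s≤s 1+i<k) (sym (injective simple {suc k} {suc (suc i)} ≤-refl 2+i≤1+k s1+k≡s2+i))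
      where
      2+i≤1+k : suc (suc i) ≤ suc k
      2+i≤1+k = <-trans 1+i<k (n<1+n k)
      i<1+k : i < suc k
      i<1+k = <-trans (n<1+n i) 2+i≤1+k
    injective′ : ∀ {i j} → i ≤ suc (suc k) → j ≤ suc (suc k) → s i ≡ s j → i ≡ j
    injective′ i≤ j≤ si≡sj with m≤n⇒m<n∨m≡n i≤ | m≤n⇒m<n∨m≡n j≤
    ... | inj₂ refl       | inj₂ refl       = refl
    ... | inj₂ refl       | inj₁ (s≤s j≤1+k) = ⊥-elim (fresh j≤1+k si≡sj)
    ... | inj₁ (s≤s i≤1+k) | inj₂ refl      = ⊥-elim (fresh i≤1+k (sym si≡sj))
    ... | inj₁ (s≤s i≤1+k) | inj₁ (s≤s j≤1+k) = injective simple i≤1+k j≤1+k si≡sj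

  Grows : Set
  Grows = ∀ {k} → Simple (suc k) → suc (suc k) < n → Simple (suc (suc k))

  grows-from-leaf : (∀ {u} → Adj G s₀ u → u ≡ s₁) → Grows
  grows-from-leaf leaf {k} simple bound with any? (λ u → Adj? G (s (suc k)) u ×-dec ¬? (u ≟ s k))
  ... | no  dead-end = ⊥-elim (prefix-escapes simple bound (λ s₀u → 1 , s≤s z≤n , leaf s₀u) end-closed)
    where
    end-closed : ∀ {u} → Adj G (s (suc k)) u → OnPrefix (suc k) u
    end-closed {u} su with u ≟ s k
    ... | yes u≡sk = k , n≤1+n k , u≡sk
    ... | no  u≢sk = ⊥-elim (dead-end (u , su , u≢sk))
  ... | yes (u , su , u≢sk) = extend simple new-edge ≢sk ≢s₀
    where
    new-edge = proj₁ (next-spec su u≢sk)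
    ≢sk = proj₂ (next-spec su u≢sk)
    ≢s₀ : s (suc (suc k)) ≢ s 0
    ≢s₀ s2+k≡s₀ with injective simple {suc k} {1} ≤-refl (s≤s z≤n) (leaf (Adj-sym-≡ G new-edge s2+k≡s₀))
    ... | refl = ≢sk s2+k≡s₀

  grows-with-two-neighbours : (∀ v → TwoNeighbours G v) → Grows
  grows-with-two-neighbours two-neighbours {k} simple bound = extend simple new-edge ≢sk ≢s₀
    where
    other : ∃ λ u → Adj G (s (suc k)) u × u ≢ s k
    other with two-neighbours (s (suc k))
    ... | a , b , sa , sb , a≢b with a ≟ s k
    ...   | yes refl = b , sb , λ b≡a → a≢b (sym b≡a)
    ...   | no  a≢sk = a , sa , a≢sk
    new-edge = proj₁ (next-spec (proj₁ (proj₂ other)) (proj₂ (proj₂ other)))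
    ≢sk = proj₂ (next-spec (proj₁ (proj₂ other)) (proj₂ (proj₂ other)))
    ≢s₀ : s (suc (suc k)) ≢ s 0
    ≢s₀ s2+k≡s₀ with k ℕ.≟ 0
    ... | yes k≡0 = subst (λ j → s (suc (suc k)) ≢ s j) k≡0 ≢sk s2+k≡s₀
    ... | no  k≢0 = prefix-escapes simple bound start-closed end-closed
      where
      start-closed : ∀ {u} → Adj G (s 0) u → OnPrefix (suc k) u
      start-closed s₀u with Δ≤2 s₀u (adjacent simple (s≤s z≤n)) (Adj-sym-≡ G new-edge s2+k≡s₀)
      ... | inj₁ u≡s₁        = 1 , s≤s z≤n , u≡s₁
      ... | inj₂ (inj₁ u≡s1+k) = suc k , ≤-refl , u≡s1+k
      ... | inj₂ (inj₂ s₁≡s1+k) = ⊥-elim (k≢0 (sym (suc-injective (injective simple (s≤s z≤n) ≤-refl s₁≡s1+k))))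
      end-closed : ∀ {u} → Adj G (s (suc k)) u → OnPrefix (suc k) u
      end-closed su with Δ≤2 su (Adj-sym G (adjacent simple ≤-refl)) new-edge
      ... | inj₁ u≡sk          = k , n≤1+n k , u≡sk
      ... | inj₂ (inj₁ u≡s2+k) = 0 , z≤n , trans u≡s2+k s2+k≡s₀
      ... | inj₂ (inj₂ sk≡s2+k) = ⊥-elim (≢sk (sym sk≡s2+k))

  simple : Grows → ∀ k → suc k < n → Simple (suc k)
  simple grows zero    _     = simple₁
  simple grows (suc k) bound = grows (simple grows k (<-trans (n<1+n (suc k)) bound)) bound

  inner-edge : ∀ {N i b} → Simple N → suc i < N → b ≤ N → Adj G (s (suc i)) (s b) → suc (suc i) ≡ b ⊎ suc b ≡ suc i
  inner-edge {i = i} simple 1+i<N b≤N s1+isb with inner-neighbours simple 1+i<N s1+isb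
  ... | inj₁ sb≡si   = inj₂ (cong suc (injective simple b≤N (≤-trans (n≤1+n i) (<⇒≤ 1+i<N)) sb≡si))
  ... | inj₂ sb≡s2+i = inj₁ (sym (injective simple b≤N 1+i<N sb≡s2+i))

  edge-classification : ∀ {N a b} → Simple N → a ≤ N → b ≤ N → Adj G (s a) (s b) →
    (suc a ≡ b ⊎ suc b ≡ a) ⊎ ((a ≡ 0 × b ≡ N) ⊎ (b ≡ 0 × a ≡ N))
  edge-classification simple a≤N b≤N sasb with position a≤N | position b≤N
  ... | inner 1+i<N | _           = inj₁ (inner-edge simple 1+i<N b≤N sasb)
  ... | first       | inner 1+j<N = inj₁ (Sum.swap (inner-edge simple 1+j<N a≤N (Adj-sym G sasb)))
  ... | last        | inner 1+j<N = inj₁ (Sum.swap (inner-edge simple 1+j<N a≤N (Adj-sym G sasb)))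
  ... | first       | first       = ⊥-elim (Adj-irrefl G sasb refl)
  ... | first       | last        = inj₂ (inj₁ (refl , refl))
  ... | last        | first       = inj₂ (inj₂ (refl , refl))
  ... | last        | last        = ⊥-elim (Adj-irrefl G sasb refl)

  consecutive⇒adjacent : ∀ {N a b} → Simple N → b ≤ N → suc a ≡ b → Adj G (s a) (s b)
  consecutive⇒adjacent simple b≤N refl = adjacent simple b≤N

  module Spanning {N} (1+N≡n : suc N ≡ n) (simple : Simple N) where

    bound : (i : Fin n) → toℕ i ≤ N
    bound i = ≤-pred (subst (toℕ i <_) (sym 1+N≡n) (toℕ<n i))

    N≡ : ∀ {m} → suc m ≡ n → N ≡ m
    N≡ 1+m≡n = suc-injective (trans 1+N≡n (sym 1+m≡n))

    σ : Permutation′ n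
    σ = injective⇒permutation (λ i → s (toℕ i)) (λ {i} {j} e → toℕ-injective (injective simple (bound i) (bound j) e))

    from-path : ∀ i j → pathAdj i j → Adj G (σ ⟨$⟩ʳ i) (σ ⟨$⟩ʳ j)
    from-path i j (inj₁ 1+i≡j) = consecutive⇒adjacent simple (bound j) 1+i≡j
    from-path i j (inj₂ 1+j≡i) = Adj-sym G (consecutive⇒adjacent simple (bound i) 1+j≡i)

    classify : ∀ i j → Adj G (σ ⟨$⟩ʳ i) (σ ⟨$⟩ʳ j) →
      pathAdj i j ⊎ ((toℕ i ≡ 0 × toℕ j ≡ N) ⊎ (toℕ j ≡ 0 × toℕ i ≡ N))
    classify i j = edge-classification simple (bound i) (bound j)

    -- The trail visits all n vertices; it closes up into a cycle exactly when its ends are adjacent.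
    pathOrCycle : IsPath G ⊎ IsCycle G
    pathOrCycle with Adj? G (s 0) (s N)
    ... | no  ¬ends = inj₁ (σ , λ i j → as-path i j , from-path i j)
      where
      as-path : ∀ i j → Adj G (σ ⟨$⟩ʳ i) (σ ⟨$⟩ʳ j) → pathAdj i j
      as-path i j σiσj with classify i j σiσj
      ... | inj₁ ij                = ij
      ... | inj₂ (inj₁ (i≡0 , j≡N)) = ⊥-elim (¬ends (subst₂ (λ a b → Adj G (s a) (s b)) i≡0 j≡N σiσj))
      ... | inj₂ (inj₂ (j≡0 , i≡N)) = ⊥-elim (¬ends (subst₂ (λ a b → Adj G (s a) (s b)) j≡0 i≡N (Adj-sym G σiσj)))
    ... | yes ends = inj₂ (σ , λ i j → as-cycle i j , from-cycle i j)
      where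
      as-cycle : ∀ i j → Adj G (σ ⟨$⟩ʳ i) (σ ⟨$⟩ʳ j) → cycleAdj i j
      as-cycle i j σiσj with classify i j σiσj
      ... | inj₁ ij                = inj₁ ij
      ... | inj₂ (inj₁ (i≡0 , j≡N)) = inj₂ (inj₁ (i≡0 , trans (cong suc j≡N) 1+N≡n))
      ... | inj₂ (inj₂ (j≡0 , i≡N)) = inj₂ (inj₂ (j≡0 , trans (cong suc i≡N) 1+N≡n))
      from-cycle : ∀ i j → cycleAdj i j → Adj G (σ ⟨$⟩ʳ i) (σ ⟨$⟩ʳ j)
      from-cycle i j (inj₁ ij)                   = from-path i j ij
      from-cycle i j (inj₂ (inj₁ (i≡0 , 1+j≡n))) = subst₂ (λ a b → Adj G (s a) (s b)) (sym i≡0) (N≡ 1+j≡n) ends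
      from-cycle i j (inj₂ (inj₂ (j≡0 , 1+i≡n))) = subst₂ (λ a b → Adj G (s a) (s b)) (N≡ 1+i≡n) (sym j≡0) (Adj-sym G ends)

  grows⇒pathOrCycle : Grows → ∀ {k} → suc (suc k) ≡ n → IsPath G ⊎ IsCycle G
  grows⇒pathOrCycle grows {k} 2+k≡n =
    Spanning.pathOrCycle 2+k≡n (simple grows k (subst (suc k <_) 2+k≡n ≤-refl))

module _ {n : ℕ} (G : Graph n) where

  maxDegree≤2⇒pathOrCycle : 3 ≤ n → Connected G → MaxDegree≤2 G → IsPath G ⊎ IsCycle G
  maxDegree≤2⇒pathOrCycle (s≤s (s≤s (s≤s _))) connected Δ≤2 with all? (twoNeighbours? G)
  ... | yes two-neighbours = grows⇒pathOrCycle (grows-with-two-neighbours two-neighbours) refl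
    where
    edge = neighbour G connected {1F} {0F} (λ ())
    open Trail G Δ≤2 connected 0F (proj₁ edge) (proj₂ edge)
  ... | no  ¬all with ¬∀⟶∃¬ _ (TwoNeighbours G) (twoNeighbours? G) ¬all
  ...   | v , ¬two = grows⇒pathOrCycle (grows-from-leaf (λ vu → ¬twoNeighbours⇒leaf G ¬two vu (proj₂ edge)))
                                       refl
    where
    edge = neighbour G connected (proj₂ (another (s≤s (s≤s z≤n)) v))
    open Trail G Δ≤2 connected v (proj₁ edge) (proj₂ edge)

-- A minimum quasi-total Roman dominating function

module Minimum {n : ℕ} (G : Graph n) (connected : Connected G) {k : ℕ} (γ : IsQTRNumber G k) where

  f : Fin n → Fin 3
  f = proj₁ (proj₁ γ)

  f-isQTRDF : IsQTRDF G f
  f-isQTRDF = proj₁ (proj₂ (proj₁ γ))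

  minimal : ∀ g → IsQTRDF G g → k ≤ weight G g
  minimal = proj₂ γ

  weight-f : weight G f ≡ k
  weight-f = proj₂ (proj₂ (proj₁ γ))

  lighter : ∀ {xs bs} → Unique xs → Pointwise (λ x b → b ≤ toℕ (f x)) xs bs → k < List.sum bs → ⊥
  lighter xs-distinct bs≤f k<sum = <⇒≱ k<sum (subst (_ ≤_) weight-f (weight-≥ G f xs-distinct bs≤f))

  zero⇒two : ∀ u → toℕ (f u) ≡ 0 → ∃ λ w → Adj G u w × toℕ (f w) ≡ 2
  zero⇒two = proj₁ f-isQTRDF

  zero⇒adjacent-to-sole-two : ∀ {u w} → toℕ (f u) ≡ 0 → (∀ {v} → toℕ (f v) ≡ 2 → v ≡ w) → Adj G u w
  zero⇒adjacent-to-sole-two {u} fu≡0 two-only-at-w with zero⇒two u fu≡0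
  ... | v , uv , fv≡2 = subst (Adj G u) (two-only-at-w fv≡2) uv

  2≤ : ∀ {x} → toℕ (f x) ≡ 2 → 2 ≤ toℕ (f x)
  2≤ fx≡2 = ≤-reflexive (sym fx≡2)

  1≤ : ∀ {x} → toℕ (f x) ≢ 0 → 1 ≤ toℕ (f x)
  1≤ = n≢0⇒n>0

  3≤k : 3 ≤ n → 3 ≤ k
  3≤k 3≤n = subst (3 ≤_) weight-f (weight≥3 G 3≤n f-isQTRDF)

  k≤n : k ≤ n
  k≤n = subst (k ≤_) (weight-one G) (minimal (one G) (one-isQTRDF G))

  two⊎k≡n : (∃ λ x → toℕ (f x) ≡ 2) ⊎ k ≡ n
  two⊎k≡n with any? (λ x → toℕ (f x) ℕ.≟ 2)
  ... | yes two = inj₁ two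
  ... | no  none = inj₂ (≤-antisym k≤n (subst (n ≤_) weight-f
          (positive⇒weight≥n G f (noTwo⇒positive G f-isQTRDF (λ x fx≡2 → none (x , fx≡2))))))

  k≡n⇒maxDegree≤2 : k ≡ n → MaxDegree≤2 G
  k≡n⇒maxDegree≤2 k≡n {v} {a} {b} {c} va vb vc with a ≟ b | a ≟ c | b ≟ c
  ... | yes a≡b | _       | _       = inj₁ a≡b
  ... | no  _   | yes a≡c | _       = inj₂ (inj₁ a≡c)
  ... | no  _   | no  _   | yes b≡c = inj₂ (inj₂ b≡c)
  ... | no  a≢b | no  a≢c | no  b≢c = ⊥-elim (1+n≰n (begin
    suc n                         ≡⟨ cong suc k≡n ⟨
    suc k                         ≤⟨ s≤s (minimal _ (claw-isQTRDF G va vb vc (≢-sym a≢c) (≢-sym b≢c))) ⟩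
    suc (weight G (claw G v a b)) ≡⟨ +-comm 1 _ ⟩
    weight G (claw G v a b) + 1   ≡⟨ weight-claw G va vb a≢b ⟩
    n                             ∎))
    where open ≤-Reasoning

  maxDegree≤2⇒k≡n : MaxDegree≤2 G → k ≡ n
  maxDegree≤2⇒k≡n Δ≤2 = ≤-antisym k≤n (subst (n ≤_) weight-f (maxDegree≤2⇒weight≥n G Δ≤2 f-isQTRDF))

  k≡n⇒hamiltonianPath : 3 ≤ n → k ≡ n → ∃ (HamiltonianPath G)
  k≡n⇒hamiltonianPath 3≤n k≡n =
    pathOrCycle⇒hamiltonianPath G (maxDegree≤2⇒pathOrCycle G 3≤n connected (k≡n⇒maxDegree≤2 k≡n))

  universal⇒k≤3 : 1 < n → ∀ {v} → Universal G v → k ≤ 3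
  universal⇒k≤3 1<n {v} v-univ = subst (k ≤_) (weight-star G y≢v) (minimal _ (star-isQTRDF G v-univ y≢v))
    where
    y≢v = proj₂ (another 1<n v)

  k≡3⇒universal : 3 ≤ n → k ≡ 3 → ∃ (Universal G)
  k≡3⇒universal 3≤n k≡3 with two⊎k≡n
  ... | inj₂ k≡n = uncurry (hamiltonianPath₃⇒universal G (trans (sym k≡n) k≡3)) (k≡n⇒hamiltonianPath 3≤n k≡n)
  ... | inj₁ (x , fx≡2) with two⇒positive-neighbour G f-isQTRDF fx≡2
  ...   | y , xy , fy≢0 = x , universal
    where
    y≢x = ≢-sym (Adj-irrefl G xy)
    k<4 = ≤-reflexive (cong suc k≡3)
    two-only-at-x : ∀ {w} → toℕ (f w) ≡ 2 → w ≡ x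
    two-only-at-x {w} fw≡2 with w ≟ x
    ... | yes w≡x = w≡x
    ... | no  w≢x = ⊥-elim (lighter (unique₂ w≢x) (2≤ fx≡2 ∷ 2≤ fw≡2 ∷ []) k<4)
    universal : Universal G x
    universal u u≢x with u ≟ y | toℕ (f u) ℕ.≟ 0
    ... | yes refl | _       = xy
    ... | no  u≢y  | no  fu≢0 = ⊥-elim (lighter (unique₃ y≢x u≢x u≢y)
                                                (2≤ fx≡2 ∷ 1≤ fy≢0 ∷ 1≤ fu≢0 ∷ []) k<4)
    ... | no  _    | yes fu≡0 = Adj-sym G (zero⇒adjacent-to-sole-two fu≡0 two-only-at-x)

  module WeightFour (k≡4 : k ≡ 4) (¬universal : ∀ {v} → ¬ Universal G v)
                    {x y} (fx≡2 : toℕ (f x) ≡ 2) (xy : Adj G x y) (fy≢0 : toℕ (f y) ≢ 0) where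

    k<5 : k < 5
    k<5 = ≤-reflexive (cong suc k≡4)

    y≢x : y ≢ x
    y≢x = ≢-sym (Adj-irrefl G xy)

    y-two⇒dominatingEdge : toℕ (f y) ≡ 2 → DominatingEdge G x y
    y-two⇒dominatingEdge fy≡2 = xy , dominated
      where
      dominated : ∀ u → u ≢ x → u ≢ y → Adj G u x ⊎ Adj G u y
      dominated u u≢x u≢y with toℕ (f u) ℕ.≟ 0
      ... | no  fu≢0 = ⊥-elim (lighter (unique₃ y≢x u≢x u≢y)
                                        (2≤ fx≡2 ∷ 2≤ fy≡2 ∷ 1≤ fu≢0 ∷ []) k<5)
      ... | yes fu≡0 with zero⇒two u fu≡0
      ...   | w , uw , fw≡2 with w ≟ x | w ≟ y
      ...     | yes refl | _        = inj₁ uw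
      ...     | no  _    | yes refl = inj₂ uw
      ...     | no  w≢x  | no  w≢y  = ⊥-elim (lighter (unique₃ y≢x w≢x w≢y)
                                                    (2≤ fx≡2 ∷ 2≤ fy≡2 ∷ 2≤ fw≡2 ∷ []) (m<n⇒m<1+n k<5))

    two-only-at-x : toℕ (f y) ≢ 2 → ∀ {w} → toℕ (f w) ≡ 2 → w ≡ x
    two-only-at-x fy≢2 {w} fw≡2 with w ≟ x | w ≟ y
    ... | yes w≡x | _        = w≡x
    ... | no  _   | yes refl = ⊥-elim (fy≢2 fw≡2)
    ... | no  w≢x | no  w≢y  = ⊥-elim (lighter (unique₃ y≢x w≢x w≢y)
                                               (2≤ fx≡2 ∷ 1≤ fy≢0 ∷ 2≤ fw≡2 ∷ []) k<5)

    others-see-x : toℕ (f y) ≢ 2 → ∀ {z} → z ≢ x → z ≢ y → toℕ (f z) ≢ 0 →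
      ∀ {u} → u ≢ x → u ≢ y → u ≢ z → Adj G u x
    others-see-x fy≢2 {z} z≢x z≢y fz≢0 {u} u≢x u≢y u≢z with toℕ (f u) ℕ.≟ 0
    ... | yes fu≡0 = zero⇒adjacent-to-sole-two fu≡0 (two-only-at-x fy≢2)
    ... | no  fu≢0 = ⊥-elim (lighter
      (unique₄ y≢x z≢x z≢y u≢x u≢y u≢z)
      (2≤ fx≡2 ∷ 1≤ fy≢0 ∷ 1≤ fz≢0 ∷ 1≤ fu≢0 ∷ []) k<5)

    -- f is 2 at x, 1 at y, and the remaining weight 1 sits on at most one further vertex z;
    -- x and a neighbour of z then dominate.
    y-one⇒dominatingEdge : toℕ (f y) ≢ 2 → ∃₂ (DominatingEdge G)
    y-one⇒dominatingEdge fy≢2 with any? (λ z → ¬? (z ≟ x) ×-dec (¬? (z ≟ y) ×-dec ¬? (toℕ (f z) ℕ.≟ 0)))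
    ... | no  none = ⊥-elim (¬universal universal)
      where
      universal : Universal G x
      universal u u≢x with u ≟ y | toℕ (f u) ℕ.≟ 0
      ... | yes refl | _        = xy
      ... | no  u≢y  | no  fu≢0 = ⊥-elim (none (u , u≢x , u≢y , fu≢0))
      ... | no  _    | yes fu≡0 = Adj-sym G (zero⇒adjacent-to-sole-two fu≡0 (two-only-at-x fy≢2))
    ... | yes (z , z≢x , z≢y , fz≢0) with neighbour G connected (≢-sym z≢x)
    ...   | d , zd with d ≟ x
    ...     | yes refl = ⊥-elim (¬universal universal)
      where
      universal : Universal G x
      universal u u≢x with u ≟ y | u ≟ z
      ... | yes refl | _        = xy
      ... | no  _    | yes refl = Adj-sym G zd
      ... | no  u≢y  | no  u≢z  = Adj-sym G (others-see-x fy≢2 z≢x z≢y fz≢0 u≢x u≢y u≢z)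
    ...     | no  d≢x  = x , d , xd , dominated
      where
      xd : Adj G x d
      xd with d ≟ y | d ≟ z
      ... | yes refl | _        = xy
      ... | no  _    | yes refl = ⊥-elim (Adj-irrefl G zd refl)
      ... | no  d≢y  | no  d≢z  = Adj-sym G (others-see-x fy≢2 z≢x z≢y fz≢0 d≢x d≢y d≢z)
      dominated : ∀ u → u ≢ x → u ≢ d → Adj G u x ⊎ Adj G u d
      dominated u u≢x _ with u ≟ y | u ≟ z
      ... | yes refl | _        = inj₁ (Adj-sym G xy)
      ... | no  _    | yes refl = inj₂ zd
      ... | no  u≢y  | no  u≢z  = inj₁ (others-see-x fy≢2 z≢x z≢y fz≢0 u≢x u≢y u≢z)

  k≡4⇒γ≡γt≡2 : 3 ≤ n → k ≡ 4 → IsDominationNumber G 2 × IsTotalDominationNumber G 2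
  k≡4⇒γ≡γt≡2 3≤n k≡4 = dominatingEdge⇒γ≡γt≡2 G ¬universal (proj₂ (proj₂ edge))
    where
    ¬universal : ∀ {v} → ¬ Universal G v
    ¬universal v-univ = 1+n≰n (subst (_≤ 3) k≡4 (universal⇒k≤3 (≤-trans (s≤s (s≤s z≤n)) 3≤n) v-univ))
    edge : ∃₂ (DominatingEdge G)
    edge with two⊎k≡n
    ... | inj₂ k≡n = uncurry (hamiltonianPath₄⇒dominatingEdge G (trans (sym k≡n) k≡4)) (k≡n⇒hamiltonianPath 3≤n k≡n)
    ... | inj₁ (x , fx≡2) with two⇒positive-neighbour G f-isQTRDF fx≡2
    ...   | y , xy , fy≢0 with toℕ (f y) ℕ.≟ 2
    ...     | yes fy≡2 = x , y , WeightFour.y-two⇒dominatingEdge k≡4 ¬universal fx≡2 xy fy≢0 fy≡2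
    ...     | no  fy≢2 = WeightFour.y-one⇒dominatingEdge k≡4 ¬universal fx≡2 xy fy≢0 fy≢2

  γ≡γt≡2⇒k≡4 : 3 ≤ n → IsDominationNumber G 2 × IsTotalDominationNumber G 2 → k ≡ 4
  γ≡γt≡2⇒k≡4 3≤n (γ≡2 , (S , S-total , ∣S∣≡2) , _) = ≤-antisym k≤4 (≤∧≢⇒< (3≤k 3≤n) 3≢k)
    where
    k≤4 : k ≤ 4
    k≤4 = subst (k ≤_) (trans (weight-double G S) (cong₂ _+_ ∣S∣≡2 ∣S∣≡2)) (minimal _ (double-isQTRDF G S-total))
    3≢k : 3 ≢ k
    3≢k 3≡k with k≡3⇒universal 3≤n (sym 3≡k)
    ... | v , v-univ = 1+n≰n (subst (2 ≤_) (∣⁅x⁆∣≡1 v) (proj₂ γ≡2 ⁅ v ⁆ (universal⇒dominating G v-univ)))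

mainTheorem7 : (n : ℕ) → 3 ≤ n → (G : Graph n) → Connected G →
    (k : ℕ) → IsQTRNumber G k →
      (3 ≤ k × k ≤ n) ×
      ((k ≡ 3) ⇔ (maxDegree G ≡ n ∸ 1)) ×
      ((k ≡ 4) ⇔ (IsDominationNumber G 2 × IsTotalDominationNumber G 2)) ×
      ((k ≡ n) ⇔ (IsPath G ⊎ IsCycle G))
mainTheorem7 n 3≤n G connected k γ =
  (3≤k 3≤n , k≤n) ,
  mk⇔ (λ k≡3 → uncurry (universal⇒maxDegree≡n∸1 G) (k≡3⇒universal 3≤n k≡3))
      (λ Δ≡n∸1 → ≤-antisym (universal⇒k≤3 1<n (proj₂ (maxDegree≡n∸1⇒universal G 1<n Δ≡n∸1))) (3≤k 3≤n)) ,
  mk⇔ (k≡4⇒γ≡γt≡2 3≤n) (γ≡γt≡2⇒k≡4 3≤n) ,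
  mk⇔ (λ k≡n → maxDegree≤2⇒pathOrCycle G 3≤n connected (k≡n⇒maxDegree≤2 k≡n))
      (λ path-or-cycle → maxDegree≤2⇒k≡n (pathOrCycle⇒MaxDegree≤2 G path-or-cycle))
  where
  open Minimum G connected γ
  1<n : 1 < n
  1<n = ≤-trans (s≤s (s≤s z≤n)) 3≤n
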